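{- Let $\mathcal{F}=(\mathcal{F}_1,\dots,\mathcal{F}_r)$ and $\mathcal{F}'=(\mathcal{F}'_1,\dots,\mathcal{F}'_r)$ be flags of type $(t_1,\dots,t_r)$ on $\mathbb{F}_q^n$ and let $\mathbf{H}$ be a subgroup of $\mathrm{GL}(n,q)$ such that $\mathrm{Orb}_{\mathbf{H}}(\mathcal{F})$ and $\mathrm{Orb}_{\mathbf{H}}(\mathcal{F}')$ are disjoint flag codes. Then: (a) If $\mathrm{Orb}_{\mathbf{H}}(\mathcal{F}_i)\neq\mathrm{Orb}_{\mathbf{H}}(\mathcal{F}'_i)$ for some $i\in\{1,\dots,r\}$, then $|\mathrm{Orb}_{\mathbf{H}}(\mathcal{F})\cup\mathrm{Orb}_{\mathbf{H}}(\mathcal{F}')|=|\mathrm{Orb}_{\mathbf{H}}(\mathcal{F})|+|\mathrm{Orb}_{\mathbf{H}}(\mathcal{F}')|$. (b) If $\mathrm{Orb}_{\mathbf{H}}(\mathcal{F}_i)\neq\mathrm{Orb}_{\mathbf{H}}(\mathcal{F}'_i)$ for all $i=1,\dots,r$, then $\mathrm{Orb}_{\mathbf{H}}(\mathcal{F})\cup\mathrm{Orb}_{\mathbf{H}}(\mathcal{F}')$ is a disjoint flag code. (c) If $\mathrm{Orb}_{\mathbf{H}}(\mathcal{F}_i)=\mathrm{Orb}_{\mathbf{H}}(\mathcal{F}'_i)$ for some $i\in\{1,\dots,r\}$, then $\mathrm{Orb}_{\mathbf{H}}(\mathcal{F})\cup\mathrm{Orb}_{\mathbf{H}}(\mathcal{F}')$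 is a disjoint flag code if and only if $\mathrm{Orb}_{\mathbf{H}}(\mathcal{F})=\mathrm{Orb}_{\mathbf{H}}(\mathcal{F}')$.
   Context: A flag of type $(t_1,\dots,t_r)$, $0<t_1<\dots<t_r<n$, is a chain $\mathcal{F}_1\subsetneq\cdots\subsetneq\mathcal{F}_r$ of subspaces of $\mathbb{F}_q^n$ with $\dim\mathcal{F}_i=t_i$. A flag code is a nonempty set $\mathcal{C}$ of flags of a fixed type; its $i$-th projected code is $\mathcal{C}_i=\{\mathcal{F}_i\mid\mathcal{F}\in\mathcal{C}\}$. $\mathcal{C}$ is called disjoint if $|\mathcal{C}|=|\mathcal{C}_1|=\dots=|\mathcal{C}_r|$. $\mathrm{GL}(n,q)$ acts on subspaces by $\mathcal{V}\cdot A=\mathrm{rowsp}(VA)$ where $\mathcal{V}=\mathrm{rowsp}(V)$, and on flags componentwise; $\mathrm{Orb}_{\mathbf{H}}$ denotes the orbit under a subgroup $\mathbf{H}$. -}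

module Defs where

open import Level using (0ℓ)
open import Data.Nat using (ℕ; zero; suc) renaming (_<_ to _<ℕ_)
open import Data.Fin using (Fin) renaming (_<_ to _<ᶠ_)
import Data.Fin as Fin
open import Data.Product using (Σ; ∃; _×_; _,_)
open import Data.Sum using (_⊎_)
open import Relation.Nullary using (¬_)
open import Relation.Binary.PropositionalEquality using (_≡_; _≢_)
open import Relation.Binary.Definitions using (DecidableEquality)
open import Algebra.Core using (Op₁; Op₂)
open import Algebra.Structures using (IsCommutativeRing)
open import Function.Bundles using (_↔_)

record FiniteField (q : ℕ) : Set₁ where
  field
    Carrier : Set
    _+_ _*_ : Op₂ Carrier
    -_      : Op₁ Carrier
    0# 1#   : Carrier
    isCommutativeRing : IsCommutativeRing _≡_ _+_ _*_ -_ 0# 1#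
    0≢1     : 0# ≢ 1#
    inverse : ∀ x → x ≢ 0# → Σ Carrier (λ y → x * y ≡ 1#)
    _≟_     : DecidableEquality Carrier
    card    : Fin q ↔ Carrier

-- Generic finite cardinality of a "set" (a predicate) on a type equipped
-- with an equivalence-like relation _≈_ (elements counted up to ≈).

HasSize : {A : Set} → (A → A → Set) → (A → Set) → ℕ → Set
HasSize {A} _≈_ P m =
  Σ (Fin m → A) λ e →
    (∀ k → P (e k)) ×
    (∀ k l → e k ≈ e l → k ≡ l) ×
    (∀ x → P x → ∃ λ k → x ≈ e k)

SameSet : {A : Set} → (A → Set) → (A → Set) → Set
SameSet {A} P Q = ∀ (x : A) → (P x → Q x) × (Q x → P x)

module LinAlg {q : ℕ} (K : FiniteField q) where
  open FiniteField K

  Vect : ℕ → Set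
  Vect n = Fin n → Carrier

  Matrix : ℕ → ℕ → Set
  Matrix m n = Fin m → Fin n → Carrier

  ∑ : ∀ {m} → (Fin m → Carrier) → Carrier
  ∑ {zero}  f = 0#
  ∑ {suc m} f = f Fin.zero + ∑ (λ i → f (Fin.suc i))

  _≈ᵥ_ : ∀ {n} → Vect n → Vect n → Set
  v ≈ᵥ w = ∀ j → v j ≡ w j

  _≈ₘ_ : ∀ {m n} → Matrix m n → Matrix m n → Set
  A ≈ₘ B = ∀ i j → A i j ≡ B i j

  _·_ : ∀ {m n} → Vect m → Matrix m n → Vect n
  (c · V) j = ∑ (λ i → c i * V i j)

  _⊗_ : ∀ {m k n} → Matrix m k → Matrix k n → Matrix m n
  (A ⊗ B) i j = ∑ (λ l → A i l * B l j)

  I : ∀ {n} → Matrix n n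
  I i j with i Fin.≟ j
  ... | Relation.Nullary.yes _ = 1#
  ... | Relation.Nullary.no  _ = 0#

  zeroV : ∀ {n} → Vect n
  zeroV _ = 0#

  _∈rowsp_ : ∀ {m n} → Vect n → Matrix m n → Set
  v ∈rowsp V = ∃ λ c → v ≈ᵥ (c · V)

  _⊆ᵣ_ : ∀ {m k n} → Matrix m n → Matrix k n → Set
  V ⊆ᵣ W = ∀ v → v ∈rowsp V → v ∈rowsp W

  _≡ᵣ_ : ∀ {m k n} → Matrix m n → Matrix k n → Set
  V ≡ᵣ W = (V ⊆ᵣ W) × (W ⊆ᵣ V)

  FullRank : ∀ {m n} → Matrix m n → Set
  FullRank V = ∀ c → (c · V) ≈ᵥ zeroV → ∀ i → c i ≡ 0#

  -- a t-dimensional subspace of F_q^n, given as rowsp of a full-rank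
  -- generator matrix
  record Subspace (t n : ℕ) : Set where
    constructor subspace
    field
      gen      : Matrix t n
      fullRank : FullRank gen
  open Subspace public

  _≈ₛ_ : ∀ {t n} → Subspace t n → Subspace t n → Set
  U ≈ₛ W = gen U ≡ᵣ gen W

  record FlagType (r n : ℕ) : Set where
    field
      dims     : Fin r → ℕ
      pos      : ∀ i → 0 <ℕ dims i
      belowN   : ∀ i → dims i <ℕ n
      increase : ∀ i j → i <ᶠ j → dims i <ℕ dims j
  open FlagType public

  -- a flag of type τ : F_1 ⊊ ... ⊊ F_r with dim F_i = t_i
  -- (properness of the inclusions follows from the distinct dimensions)
  record Flag {r n : ℕ} (τ : FlagType r n) : Set where
    constructor flag
    field
      sub    : (i : Fin r) → Subspace (dims τ i) n
      nested : ∀ i j → i <ᶠ j → gen (sub i) ⊆ᵣ gen (sub j)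
  open Flag public

  _≈F_ : ∀ {r n} {τ : FlagType r n} → Flag τ → Flag τ → Set
  X ≈F Y = ∀ i → sub X i ≈ₛ sub Y i

  Invertible : ∀ {n} → Matrix n n → Set
  Invertible A = ∃ λ B → ((A ⊗ B) ≈ₘ I) × ((B ⊗ A) ≈ₘ I)

  record IsSubgroupGL {n : ℕ} (H : Matrix n n → Set) : Set where
    field
      respects  : ∀ A B → A ≈ₘ B → H A → H B
      invertible : ∀ A → H A → Invertible A
      hasId     : H I
      closed    : ∀ A B → H A → H B → H (A ⊗ B)
      hasInv    : ∀ A → H A → ∃ λ B → H B × ((A ⊗ B) ≈ₘ I) × ((B ⊗ A) ≈ₘ I)

  OrbSub : ∀ {t n} → (Matrix n n → Set) → Subspace t n → Subspace t n → Set
  OrbSub H U W = ∃ λ A → H A × (gen W ≡ᵣ (gen U ⊗ A))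

  OrbFlag : ∀ {r n} {τ : FlagType r n} → (Matrix n n → Set) →
            Flag τ → Flag τ → Set
  OrbFlag H F X = ∃ λ A → H A × (∀ i → gen (sub X i) ≡ᵣ (gen (sub F i) ⊗ A))

  Code : ∀ {r n} → FlagType r n → Set₁
  Code τ = Flag τ → Set

  projected : ∀ {r n} {τ : FlagType r n} → Code τ → (i : Fin r) →
              Subspace (dims τ i) n → Set
  projected C i W = ∃ λ X → C X × (W ≈ₛ sub X i)

  _∪_ : ∀ {r n} {τ : FlagType r n} → Code τ → Code τ → Code τ
  (C ∪ D) X = C X ⊎ D X

  IsDisjointFlagCode : ∀ {r n} {τ : FlagType r n} → Code τ → Set
  IsDisjointFlagCode {τ = τ} C =
    (∃ λ X → C X) ×
    (∃ λ m → HasSize _≈F_ C m ×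
             (∀ i → HasSize _≈ₛ_ (projected C i) m))

-- Orbits under a subgroup H are the classes of an equivalence relation, so two orbits coincide or are
-- disjoint, and the i-th projected code of Orb_H(F) is Orb_H(F_i). If Orb_H(F_i) ≠ Orb_H(F'_i), the two
-- flag orbits and their i-th projected codes are therefore disjoint and cardinalities add, giving (a)
-- and (b). If Orb_H(F_i) = Orb_H(F'_i), the i-th projected code of the union is that of Orb_H(F), so a
-- disjoint union has at most |Orb_H(F)| flags while containing Orb_H(F) and F'; by pigeonhole F' lies
-- in Orb_H(F), giving (c).
module Submission where

open import Defs
open import Level using (0ℓ)
open import Algebra.Bundles using (CommutativeRing)
open import Algebra.Structures using (IsCommutativeRing)
import Algebra.Properties.Semiring.Sum as SemiringSum
open import Data.Nat using (ℕ; _+_; zero; suc; _≤_; s≤s)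
open import Data.Fin using (Fin; zero; suc; _↑ˡ_; _↑ʳ_; splitAt; join; punchIn) renaming (_<_ to _<ᶠ_)
import Data.Fin as Fin
open import Data.Fin.Properties
  using (splitAt-↑ˡ; splitAt-↑ʳ; join-splitAt; punchInᵢ≢i; pigeonhole; injective⇒≤; <-irrefl)
open import Data.Product using (_×_; ∃; ∃₂; _,_; proj₁; proj₂)
open import Data.Sum using (_⊎_; inj₁; inj₂; [_,_]′)
open import Data.Empty using (⊥-elim)
open import Function using (_∘_)
open import Relation.Binary.Structures using (IsEquivalence)
open import Relation.Binary.PropositionalEquality
  using (_≡_; _≢_; refl; sym; trans; cong; cong₂; subst; module ≡-Reasoning)
open import Relation.Nullary using (¬_; yes; no)

common-element⇒SameSet : {A : Set} {R : A → A → Set} → IsEquivalence R →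
                         ∀ {a b x} → R a x → R b x → SameSet (R a) (R b)
common-element⇒SameSet R-equiv a~x b~x y =
  (λ a~y → R-trans (R-trans b~x (R-sym a~x)) a~y) , (λ b~y → R-trans (R-trans a~x (R-sym b~x)) b~y)
  where open IsEquivalence R-equiv renaming (sym to R-sym; trans to R-trans)

module _ {A : Set} {_≈_ : A → A → Set} where

  HasSize-cong : ∀ {P Q : A → Set} {m} → SameSet P Q → HasSize _≈_ P m → HasSize _≈_ Q m
  HasSize-cong P≐Q (e , e∈P , e-inj , e-onto) =
    e , (λ k → proj₁ (P≐Q (e k)) (e∈P k)) , e-inj , (λ x x∈Q → e-onto x (proj₂ (P≐Q x) x∈Q))

module _ {A : Set} {_≈_ : A → A → Set} (≈-isEquivalence : IsEquivalence _≈_) where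
  open IsEquivalence ≈-isEquivalence renaming (sym to ≈-sym; trans to ≈-trans)

  HasSize-⊎ : ∀ {P Q : A → Set} {m m'} → (∀ {x y} → P x → Q y → ¬ x ≈ y) →
              HasSize _≈_ P m → HasSize _≈_ Q m' → HasSize _≈_ (λ x → P x ⊎ Q x) (m + m')
  HasSize-⊎ {P} {Q} {m} {m'} P∦Q (e , e∈P , e-inj , e-onto) (e' , e'∈Q , e'-inj , e'-onto) =
    E ∘ splitAt m , E∈ ∘ splitAt m , E∘splitAt-injective , onto
    where
    E : Fin m ⊎ Fin m' → A
    E = [ e , e' ]′

    E∈ : ∀ s → P (E s) ⊎ Q (E s)
    E∈ (inj₁ k) = inj₁ (e∈P k)
    E∈ (inj₂ k) = inj₂ (e'∈Q k)

    E-injective : ∀ s t → E s ≈ E t → s ≡ t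
    E-injective (inj₁ k) (inj₁ l) eq = cong inj₁ (e-inj k l eq)
    E-injective (inj₁ k) (inj₂ l) eq = ⊥-elim (P∦Q (e∈P k) (e'∈Q l) eq)
    E-injective (inj₂ k) (inj₁ l) eq = ⊥-elim (P∦Q (e∈P l) (e'∈Q k) (≈-sym eq))
    E-injective (inj₂ k) (inj₂ l) eq = cong inj₂ (e'-inj k l eq)

    E∘splitAt-injective : ∀ k l → E (splitAt m k) ≈ E (splitAt m l) → k ≡ l
    E∘splitAt-injective k l eq = begin
      k                       ≡⟨ join-splitAt m m' k ⟨
      join m m' (splitAt m k) ≡⟨ cong (join m m') (E-injective (splitAt m k) (splitAt m l) eq) ⟩
      join m m' (splitAt m l) ≡⟨ join-splitAt m m' l ⟩
      l                       ∎
      where open ≡-Reasoning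

    onto : ∀ x → P x ⊎ Q x → ∃ λ k → x ≈ E (splitAt m k)
    onto x (inj₁ x∈P) =
      let k , x≈ek = e-onto x x∈P
      in k ↑ˡ m' , subst (λ s → x ≈ E s) (sym (splitAt-↑ˡ m k m')) x≈ek
    onto x (inj₂ x∈Q) =
      let k , x≈e'k = e'-onto x x∈Q
      in m ↑ʳ k , subst (λ s → x ≈ E s) (sym (splitAt-↑ʳ m m' k)) x≈e'k

  module _ {P Q : A → Set} {k m} (P⊆Q : ∀ {x} → P x → Q x)
           (P-size : HasSize _≈_ P k) (Q-size : HasSize _≈_ Q m) where
    private
      e : Fin k → A
      e = proj₁ P-size

      e∈P : ∀ j → P (e j)
      e∈P = proj₁ (proj₂ P-size)

      e' : Fin m → A
      e' = proj₁ Q-size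

      slot : ∀ {x} → Q x → Fin m
      slot x∈Q = proj₁ (proj₂ (proj₂ (proj₂ Q-size)) _ x∈Q)

      at-slot : ∀ {x} (x∈Q : Q x) → x ≈ e' (slot x∈Q)
      at-slot x∈Q = proj₂ (proj₂ (proj₂ (proj₂ Q-size)) _ x∈Q)

      index : Fin k → Fin m
      index j = slot (P⊆Q (e∈P j))

      index-injective : ∀ i j → index i ≡ index j → i ≡ j
      index-injective i j eq = proj₁ (proj₂ (proj₂ P-size)) i j
        (≈-trans (subst (λ s → e i ≈ e' s) eq (at-slot _)) (≈-sym (at-slot _)))

    HasSize-⊆⇒≤ : k ≤ m
    HasSize-⊆⇒≤ = injective⇒≤ {f = index} (index-injective _ _)

    -- Pigeonhole: x and the k elements of P are k + 1 elements of Q, which has only m ≤ k slots.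
    HasSize-⊆-≤⇒⊇ : m ≤ k → ∀ {x} → Q x → ∃ λ y → P y × x ≈ y
    HasSize-⊆-≤⇒⊇ m≤k {x} x∈Q = collision (pigeonhole (s≤s m≤k) f)
      where
      f : Fin (suc k) → Fin m
      f zero    = slot x∈Q
      f (suc j) = index j

      collision : (∃₂ λ i j → i <ᶠ j × f i ≡ f j) → ∃ λ y → P y × x ≈ y
      collision (zero , suc j , _ , eq) =
        e j , e∈P j , ≈-trans (subst (λ s → x ≈ e' s) eq (at-slot x∈Q)) (≈-sym (at-slot _))
      collision (suc i , suc j , i<j , eq) = ⊥-elim (<-irrefl (cong suc (index-injective i j eq)) i<j)

module FlagOrbits {q : ℕ} (K : FiniteField q) where
  open FiniteField K using (Carrier; 0#; 1#; isCommutativeRing) renaming (_+_ to _+ₖ_; _*_ to _*ₖ_)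
  open IsCommutativeRing isCommutativeRing using (*-assoc; zeroˡ; zeroʳ; *-identityʳ; +-identityʳ)
  open LinAlg K

  private
    K-ring : CommutativeRing 0ℓ 0ℓ
    K-ring = record
      { Carrier = Carrier ; _≈_ = _≡_ ; _+_ = _+ₖ_ ; _*_ = _*ₖ_ ; -_ = FiniteField.-_ K
      ; 0# = 0# ; 1# = 1# ; isCommutativeRing = isCommutativeRing }

  open SemiringSum (CommutativeRing.semiring K-ring)
    using (sum; sum-cong-≗; ∑-comm; *-distribˡ-sum; *-distribʳ-sum; sum-remove; sum-replicate-zero)

  ∑≡sum : ∀ {m} (f : Fin m → Carrier) → ∑ f ≡ sum f
  ∑≡sum {zero}  f = refl
  ∑≡sum {suc m} f = cong (f zero +ₖ_) (∑≡sum (f ∘ suc))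

  ∑-cong : ∀ {m} {f g : Fin m → Carrier} → (∀ i → f i ≡ g i) → ∑ f ≡ ∑ g
  ∑-cong {f = f} {g} f≗g = trans (∑≡sum f) (trans (sum-cong-≗ f≗g) (sym (∑≡sum g)))

  ∑-*ˡ : ∀ {m} a (f : Fin m → Carrier) → ∑ (λ i → a *ₖ f i) ≡ a *ₖ ∑ f
  ∑-*ˡ a f = trans (∑≡sum (λ i → a *ₖ f i)) (sym (trans (cong (a *ₖ_) (∑≡sum f)) (*-distribˡ-sum a f)))

  ∑-*ʳ : ∀ {m} a (f : Fin m → Carrier) → ∑ (λ i → f i *ₖ a) ≡ ∑ f *ₖ a
  ∑-*ʳ a f = trans (∑≡sum (λ i → f i *ₖ a)) (sym (trans (cong (_*ₖ a) (∑≡sum f)) (*-distribʳ-sum a f)))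

  ∑-swap : ∀ {a b} (f : Fin a → Fin b → Carrier) → ∑ (λ i → ∑ (f i)) ≡ ∑ (λ j → ∑ (λ i → f i j))
  ∑-swap f = begin
    ∑ (λ i → ∑ (f i))              ≡⟨ trans (∑≡sum (λ i → ∑ (f i))) (sum-cong-≗ (λ i → ∑≡sum (f i))) ⟩
    sum (λ i → sum (f i))          ≡⟨ ∑-comm f ⟩
    sum (λ j → sum (λ i → f i j))  ≡⟨ trans (∑≡sum (λ j → ∑ (λ i → f i j))) (sum-cong-≗ (λ j → ∑≡sum (λ i → f i j))) ⟨
    ∑ (λ j → ∑ (λ i → f i j))      ∎
    where open ≡-Reasoning

  ∑∑-assoc : ∀ {a b} (x : Fin a → Carrier) (M : Matrix a b) (y : Fin b → Carrier) →
             ∑ (λ l → ∑ (λ k → x k *ₖ M k l) *ₖ y l) ≡ ∑ (λ k → x k *ₖ ∑ (λ l → M k l *ₖ y l))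
  ∑∑-assoc x M y = begin
    ∑ (λ l → ∑ (λ k → x k *ₖ M k l) *ₖ y l)    ≡⟨ ∑-cong (λ l → ∑-*ʳ (y l) (λ k → x k *ₖ M k l)) ⟨
    ∑ (λ l → ∑ (λ k → (x k *ₖ M k l) *ₖ y l))  ≡⟨ ∑-cong (λ l → ∑-cong (λ k → *-assoc (x k) (M k l) (y l))) ⟩
    ∑ (λ l → ∑ (λ k → x k *ₖ (M k l *ₖ y l)))  ≡⟨ ∑-swap (λ l k → x k *ₖ (M k l *ₖ y l)) ⟩
    ∑ (λ k → ∑ (λ l → x k *ₖ (M k l *ₖ y l)))  ≡⟨ ∑-cong (λ k → ∑-*ˡ (x k) (λ l → M k l *ₖ y l)) ⟩
    ∑ (λ k → x k *ₖ ∑ (λ l → M k l *ₖ y l))    ∎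
    where open ≡-Reasoning

  I-diagonal : ∀ {n} (i : Fin n) → I i i ≡ 1#
  I-diagonal i with i Fin.≟ i
  ... | yes _   = refl
  ... | no i≢i = ⊥-elim (i≢i refl)

  I-off-diagonal : ∀ {n} {i j : Fin n} → i ≢ j → I i j ≡ 0#
  I-off-diagonal {i = i} {j} i≢j with i Fin.≟ j
  ... | yes i≡j = ⊥-elim (i≢j i≡j)
  ... | no _    = refl

  ∑-*I : ∀ {n} (f : Fin n → Carrier) (j : Fin n) → ∑ (λ l → f l *ₖ I l j) ≡ f j
  ∑-*I {suc n} f j = begin
    ∑ (λ l → f l *ₖ I l j)                                                ≡⟨ ∑≡sum (λ l → f l *ₖ I l j) ⟩
    sum (λ l → f l *ₖ I l j)                                              ≡⟨ sum-remove {i = j} (λ l → f l *ₖ I l j) ⟩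
    (f j *ₖ I j j) +ₖ sum (λ k → f (punchIn j k) *ₖ I (punchIn j k) j)    ≡⟨ cong₂ _+ₖ_ diagonal off-diagonal ⟩
    f j +ₖ 0#                                                             ≡⟨ +-identityʳ (f j) ⟩
    f j                                                                   ∎
    where
    open ≡-Reasoning
    diagonal : f j *ₖ I j j ≡ f j
    diagonal = trans (cong (f j *ₖ_) (I-diagonal j)) (*-identityʳ (f j))
    off-diagonal : sum (λ k → f (punchIn j k) *ₖ I (punchIn j k) j) ≡ 0#
    off-diagonal = trans (sum-cong-≗ (λ k → trans (cong (_ *ₖ_) (I-off-diagonal (punchInᵢ≢i j k))) (zeroʳ _)))
                         (sum-replicate-zero n)

  ⊗-assoc : ∀ {a b c d} (M : Matrix a b) (N : Matrix b c) (P : Matrix c d) → ((M ⊗ N) ⊗ P) ≈ₘ (M ⊗ (N ⊗ P))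
  ⊗-assoc M N P i j = ∑∑-assoc (M i) N (λ l → P l j)

  ⊗-identityʳ : ∀ {a b} (M : Matrix a b) → (M ⊗ I) ≈ₘ M
  ⊗-identityʳ M i = ∑-*I (M i)

  ·-⊗ : ∀ {a b c} (x : Vect a) (M : Matrix a b) (N : Matrix b c) → ((x · M) · N) ≈ᵥ (x · (M ⊗ N))
  ·-⊗ x M N j = ∑∑-assoc x M (λ l → N l j)

  ·-identityʳ : ∀ {a} (x : Vect a) → (x · I) ≈ᵥ x
  ·-identityʳ = ∑-*I

  ·-congˡ : ∀ {a b} {v w : Vect a} (M : Matrix a b) → v ≈ᵥ w → (v · M) ≈ᵥ (w · M)
  ·-congˡ M v≈w j = ∑-cong (λ i → cong (_*ₖ M i j) (v≈w i))

  ·-congʳ : ∀ {a b} (v : Vect a) {M N : Matrix a b} → M ≈ₘ N → (v · M) ≈ᵥ (v · N)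
  ·-congʳ v M≈N j = ∑-cong (λ i → cong (v i *ₖ_) (M≈N i j))

  zeroV-· : ∀ {a b} (M : Matrix a b) → (zeroV · M) ≈ᵥ zeroV
  zeroV-· M j = trans (∑-*ˡ 0# (λ i → M i j)) (zeroˡ _)

  ⊆ᵣ-trans : ∀ {a b c n} {U : Matrix a n} {V : Matrix b n} {W : Matrix c n} → U ⊆ᵣ V → V ⊆ᵣ W → U ⊆ᵣ W
  ⊆ᵣ-trans U⊆V V⊆W v v∈U = V⊆W v (U⊆V v v∈U)

  ≡ᵣ-refl : ∀ {a n} {V : Matrix a n} → V ≡ᵣ V
  ≡ᵣ-refl = (λ _ v∈V → v∈V) , (λ _ v∈V → v∈V)

  ≡ᵣ-sym : ∀ {a b n} {U : Matrix a n} {V : Matrix b n} → U ≡ᵣ V → V ≡ᵣ U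
  ≡ᵣ-sym (U⊆V , V⊆U) = V⊆U , U⊆V

  ≡ᵣ-trans : ∀ {a b c n} {U : Matrix a n} {V : Matrix b n} {W : Matrix c n} → U ≡ᵣ V → V ≡ᵣ W → U ≡ᵣ W
  ≡ᵣ-trans (U⊆V , V⊆U) (V⊆W , W⊆V) = ⊆ᵣ-trans U⊆V V⊆W , ⊆ᵣ-trans W⊆V V⊆U

  ≈ₘ⇒⊆ᵣ : ∀ {a n} {M N : Matrix a n} → M ≈ₘ N → M ⊆ᵣ N
  ≈ₘ⇒⊆ᵣ M≈N v (c , v≈cM) = c , λ j → trans (v≈cM j) (·-congʳ c M≈N j)

  ≈ₘ⇒≡ᵣ : ∀ {a n} {M N : Matrix a n} → M ≈ₘ N → M ≡ᵣ N
  ≈ₘ⇒≡ᵣ M≈N = ≈ₘ⇒⊆ᵣ M≈N , ≈ₘ⇒⊆ᵣ (λ i j → sym (M≈N i j))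

  ⊗-monoˡ-⊆ᵣ : ∀ {a b n} {V : Matrix a n} {W : Matrix b n} (A : Matrix n n) → V ⊆ᵣ W → (V ⊗ A) ⊆ᵣ (W ⊗ A)
  ⊗-monoˡ-⊆ᵣ {V = V} {W} A V⊆W v (c , v≈c[VA]) =
    let d , cV≈dW = V⊆W (c · V) (c , λ _ → refl)
    in d , λ j → trans (v≈c[VA] j) (trans (sym (·-⊗ c V A j)) (trans (·-congˡ A cV≈dW j) (·-⊗ d W A j)))

  ⊗-congˡ-≡ᵣ : ∀ {a b n} {V : Matrix a n} {W : Matrix b n} (A : Matrix n n) → V ≡ᵣ W → (V ⊗ A) ≡ᵣ (W ⊗ A)
  ⊗-congˡ-≡ᵣ A (V⊆W , W⊆V) = ⊗-monoˡ-⊆ᵣ A V⊆W , ⊗-monoˡ-⊆ᵣ A W⊆V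

  FullRank-⊗ : ∀ {a n} {V : Matrix a n} {A B : Matrix n n} → FullRank V → (A ⊗ B) ≈ₘ I → FullRank (V ⊗ A)
  FullRank-⊗ {V = V} {A} {B} V-fullRank AB≈I c c[VA]≈0 = V-fullRank c λ j → begin
    (c · V) j                ≡⟨ ·-identityʳ (c · V) j ⟨
    ((c · V) · I) j          ≡⟨ ·-congʳ (c · V) AB≈I j ⟨
    ((c · V) · (A ⊗ B)) j    ≡⟨ ·-⊗ c V (A ⊗ B) j ⟩
    (c · (V ⊗ (A ⊗ B))) j    ≡⟨ ·-congʳ c (⊗-assoc V A B) j ⟨
    (c · ((V ⊗ A) ⊗ B)) j    ≡⟨ ·-⊗ c (V ⊗ A) B j ⟨
    ((c · (V ⊗ A)) · B) j    ≡⟨ ·-congˡ B c[VA]≈0 j ⟩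
    (zeroV · B) j            ≡⟨ zeroV-· B j ⟩
    0#                       ∎
    where open ≡-Reasoning

  ≡ᵣ-⊗-identity : ∀ {a n} (V : Matrix a n) → V ≡ᵣ (V ⊗ I)
  ≡ᵣ-⊗-identity V = ≡ᵣ-sym (≈ₘ⇒≡ᵣ (⊗-identityʳ V))

  ≡ᵣ-⊗-compose : ∀ {a b c n} {U : Matrix a n} {V : Matrix b n} {W : Matrix c n} {A B : Matrix n n} →
                 V ≡ᵣ (U ⊗ A) → W ≡ᵣ (V ⊗ B) → W ≡ᵣ (U ⊗ (A ⊗ B))
  ≡ᵣ-⊗-compose {U = U} {A = A} {B} V≡UA W≡VB =
    ≡ᵣ-trans W≡VB (≡ᵣ-trans (⊗-congˡ-≡ᵣ B V≡UA) (≈ₘ⇒≡ᵣ (⊗-assoc U A B)))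

  ≡ᵣ-⊗-invert : ∀ {a b n} {U : Matrix a n} {V : Matrix b n} {A A' : Matrix n n} →
                (A ⊗ A') ≈ₘ I → V ≡ᵣ (U ⊗ A) → U ≡ᵣ (V ⊗ A')
  ≡ᵣ-⊗-invert {U = U} {A = A} {A'} AA'≈I V≡UA =
    ≡ᵣ-trans (≡ᵣ-⊗-identity U)
    (≡ᵣ-trans (≈ₘ⇒≡ᵣ (λ i → ·-congʳ (U i) (λ k l → sym (AA'≈I k l))))
    (≡ᵣ-trans (≈ₘ⇒≡ᵣ (λ i j → sym (⊗-assoc U A A' i j)))
              (⊗-congˡ-≡ᵣ A' (≡ᵣ-sym V≡UA))))

  -- gen is a projection, so Agda cannot infer subspaces or flags from ≈ₛ-, OrbSub- or OrbFlag-typed arguments.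
  ≈ₛ-sym : ∀ {t n} {U W : Subspace t n} → U ≈ₛ W → W ≈ₛ U
  ≈ₛ-sym = ≡ᵣ-sym

  ≈ₛ-isEquivalence : ∀ {t n} → IsEquivalence (_≈ₛ_ {t} {n})
  ≈ₛ-isEquivalence = record
    { refl  = λ {U} → ≡ᵣ-refl {V = gen U}
    ; sym   = λ {U} {W} → ≈ₛ-sym {U = U} {W}
    ; trans = λ {U} {V} {W} → ≡ᵣ-trans {U = gen U} {gen V} {gen W}
    }

  ≈F-isEquivalence : ∀ {r n} {τ : FlagType r n} → IsEquivalence (_≈F_ {τ = τ})
  ≈F-isEquivalence = record
    { refl  = λ _ → ≡ᵣ-refl
    ; sym   = λ X≈Y i → ≡ᵣ-sym (X≈Y i)
    ; trans = λ X≈Y Y≈Z i → ≡ᵣ-trans (X≈Y i) (Y≈Z i)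
    }

  flag-⊗ : ∀ {r n} {τ : FlagType r n} → Flag τ → (A : Matrix n n) → Invertible A → Flag τ
  flag-⊗ F A (_ , AB≈I , _) = flag
    (λ i → subspace (gen (sub F i) ⊗ A) (FullRank-⊗ (fullRank (sub F i)) AB≈I))
    (λ i j i<j → ⊗-monoˡ-⊆ᵣ A (nested F i j i<j))

  module _ {r n} {τ : FlagType r n} where

    projected-cong : {C D : Code τ} → SameSet C D → ∀ i → SameSet (projected C i) (projected D i)
    projected-cong C≐D i W =
      (λ (X , X∈C , W≈Xᵢ) → X , proj₁ (C≐D X) X∈C , W≈Xᵢ) ,
      (λ (X , X∈D , W≈Xᵢ) → X , proj₂ (C≐D X) X∈D , W≈Xᵢ)

    projected-∪ : (C D : Code τ) → ∀ i →
                  SameSet (λ W → projected C i W ⊎ projected D i W) (projected (C ∪ D) i)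
    projected-∪ C D i W = to , from
      where
      to : projected C i W ⊎ projected D i W → projected (C ∪ D) i W
      to (inj₁ (X , X∈C , W≈Xᵢ)) = X , inj₁ X∈C , W≈Xᵢ
      to (inj₂ (X , X∈D , W≈Xᵢ)) = X , inj₂ X∈D , W≈Xᵢ
      from : projected (C ∪ D) i W → projected C i W ⊎ projected D i W
      from (X , inj₁ X∈C , W≈Xᵢ) = inj₁ (X , X∈C , W≈Xᵢ)
      from (X , inj₂ X∈D , W≈Xᵢ) = inj₂ (X , X∈D , W≈Xᵢ)

    IsDisjointFlagCode-cong : {C D : Code τ} → SameSet C D → IsDisjointFlagCode C → IsDisjointFlagCode D
    IsDisjointFlagCode-cong C≐D ((X , X∈C) , m , C-size , Cᵢ-size) =
      (X , proj₁ (C≐D X) X∈C) , m , HasSize-cong {_≈_ = _≈F_} C≐D C-size ,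
      λ i → HasSize-cong {_≈_ = _≈ₛ_} (projected-cong C≐D i) (Cᵢ-size i)

    IsDisjointFlagCode-∪ : {C D : Code τ} → SameSet C D → IsDisjointFlagCode C → IsDisjointFlagCode (C ∪ D)
    IsDisjointFlagCode-∪ {C} C≐D = IsDisjointFlagCode-cong λ X →
      inj₁ , [ (λ X∈C → X∈C) , proj₂ (C≐D X) ]′

  module Orbits {n} {H : Matrix n n → Set} (H-subgroup : IsSubgroupGL H) where
    open IsSubgroupGL H-subgroup

    OrbSub-isEquivalence : ∀ {t} → IsEquivalence (OrbSub {t} H)
    OrbSub-isEquivalence = record
      { refl  = I , hasId , ≡ᵣ-⊗-identity _
      ; sym   = λ (A , A∈H , W≡UA) →
                  let A' , A'∈H , AA'≈I , _ = hasInv A A∈H in A' , A'∈H , ≡ᵣ-⊗-invert AA'≈I W≡UA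
      ; trans = λ (A , A∈H , V≡UA) (B , B∈H , W≡VB) → A ⊗ B , closed A B A∈H B∈H , ≡ᵣ-⊗-compose V≡UA W≡VB
      }

    OrbFlag-isEquivalence : ∀ {r} {τ : FlagType r n} → IsEquivalence (OrbFlag {τ = τ} H)
    OrbFlag-isEquivalence = record
      { refl  = I , hasId , λ i → ≡ᵣ-⊗-identity _
      ; sym   = λ (A , A∈H , X≡FA) →
                  let A' , A'∈H , AA'≈I , _ = hasInv A A∈H in A' , A'∈H , λ i → ≡ᵣ-⊗-invert AA'≈I (X≡FA i)
      ; trans = λ (A , A∈H , Y≡XA) (B , B∈H , Z≡YB) →
                  A ⊗ B , closed A B A∈H B∈H , λ i → ≡ᵣ-⊗-compose (Y≡XA i) (Z≡YB i)
      }

    OrbSub-respʳ : ∀ {t} {U W W' : Subspace t n} → W ≈ₛ W' → OrbSub H U W → OrbSub H U W'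
    OrbSub-respʳ W≈W' (A , A∈H , W≡UA) = A , A∈H , ≡ᵣ-trans (≡ᵣ-sym W≈W') W≡UA

    OrbFlag-respʳ : ∀ {r} {τ : FlagType r n} {F X Y : Flag τ} → X ≈F Y → OrbFlag H F X → OrbFlag H F Y
    OrbFlag-respʳ X≈Y (A , A∈H , X≡FA) = A , A∈H , λ i → ≡ᵣ-trans (≡ᵣ-sym (X≈Y i)) (X≡FA i)

    OrbFlag⇒OrbSub : ∀ {r} {τ : FlagType r n} {F X : Flag τ} → OrbFlag H F X → ∀ i → OrbSub H (sub F i) (sub X i)
    OrbFlag⇒OrbSub (A , A∈H , X≡FA) i = A , A∈H , X≡FA i

    OrbFlag-of-empty-type : {τ : FlagType 0 n} (F X : Flag τ) → OrbFlag H F X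
    OrbFlag-of-empty-type F X = I , hasId , λ ()

    projected-OrbFlag : ∀ {r} {τ : FlagType r n} (F : Flag τ) i →
                        SameSet (projected (OrbFlag H F) i) (OrbSub H (sub F i))
    projected-OrbFlag F i W =
      (λ (X , F~X , W≈Xᵢ) → OrbSub-respʳ {U = sub F i} {sub X i} {W}
                               (≈ₛ-sym {U = W} {sub X i} W≈Xᵢ) (OrbFlag⇒OrbSub {F = F} {X} F~X i)) ,
      (λ (A , A∈H , W≡FᵢA) → flag-⊗ F A (invertible A A∈H) ,
                               (A , A∈H , λ j → ≡ᵣ-refl {V = gen (sub F j) ⊗ A}) , W≡FᵢA)

    same-orbit : ∀ {r} {τ : FlagType r n} {F F' : Flag τ} → OrbFlag H F F' → SameSet (OrbFlag H F) (OrbFlag H F')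
    same-orbit {F = F} {F'} F~F' =
      common-element⇒SameSet OrbFlag-isEquivalence {F} {F'} {F'} F~F' (IsEquivalence.refl OrbFlag-isEquivalence {F'})

    OrbSub-disjoint : ∀ {t} {U U' W W' : Subspace t n} → ¬ SameSet (OrbSub H U) (OrbSub H U') →
                      OrbSub H U W → OrbSub H U' W' → ¬ W ≈ₛ W'
    OrbSub-disjoint {U = U} {U'} {W} {W'} U≠U' U~W U'~W' W≈W' = U≠U'
      (common-element⇒SameSet OrbSub-isEquivalence {U} {U'} {W} U~W
        (OrbSub-respʳ {U = U'} {W'} {W} (≈ₛ-sym {U = W} {W'} W≈W') U'~W'))

    module _ {r} {τ : FlagType r n} {F F' : Flag τ} (i : Fin r)
             (Fᵢ≠F'ᵢ : ¬ SameSet (OrbSub H (sub F i)) (OrbSub H (sub F' i))) where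

      OrbFlag-disjoint : ∀ {X Y} → OrbFlag H F X → OrbFlag H F' Y → ¬ X ≈F Y
      OrbFlag-disjoint {X} {Y} F~X F'~Y X≈Y =
        OrbSub-disjoint {U = sub F i} {sub F' i} {sub X i} {sub Y i} Fᵢ≠F'ᵢ
          (OrbFlag⇒OrbSub {F = F} {X} F~X i) (OrbFlag⇒OrbSub {F = F'} {Y} F'~Y i) (X≈Y i)

      projected-OrbFlag-disjoint : ∀ {W W'} → projected (OrbFlag H F) i W → projected (OrbFlag H F') i W' → ¬ W ≈ₛ W'
      projected-OrbFlag-disjoint {W} {W'} W∈Fᵢ W'∈F'ᵢ =
        OrbSub-disjoint {U = sub F i} {sub F' i} {W} {W'} Fᵢ≠F'ᵢ
          (proj₁ (projected-OrbFlag F i W) W∈Fᵢ) (proj₁ (projected-OrbFlag F' i W') W'∈F'ᵢ)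

      HasSize-OrbFlag-∪ : ∀ {m m'} → HasSize _≈F_ (OrbFlag H F) m → HasSize _≈F_ (OrbFlag H F') m' →
                          HasSize _≈F_ (OrbFlag H F ∪ OrbFlag H F') (m + m')
      HasSize-OrbFlag-∪ = HasSize-⊎ ≈F-isEquivalence (λ {X} {Y} → OrbFlag-disjoint {X} {Y})

    IsDisjointFlagCode-OrbFlag-∪ : ∀ {r} {τ : FlagType r n} {F F' : Flag τ} →
      IsDisjointFlagCode (OrbFlag H F) → IsDisjointFlagCode (OrbFlag H F') →
      (∀ i → ¬ SameSet (OrbSub H (sub F i)) (OrbSub H (sub F' i))) →
      IsDisjointFlagCode (OrbFlag H F ∪ OrbFlag H F')
    IsDisjointFlagCode-OrbFlag-∪ {zero} {F = F} {F'} F-code _ _ =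
      IsDisjointFlagCode-∪ (same-orbit {F = F} {F'} (OrbFlag-of-empty-type F F')) F-code
    IsDisjointFlagCode-OrbFlag-∪ {suc r} {F = F} {F'}
      ((X , F~X) , m , F-size , Fᵢ-size) (_ , m' , F'-size , F'ᵢ-size) Fᵢ≠F'ᵢ =
      (X , inj₁ F~X) , m + m' , HasSize-OrbFlag-∪ {F = F} {F'} zero (Fᵢ≠F'ᵢ zero) F-size F'-size ,
      λ i → HasSize-cong {_≈_ = _≈ₛ_} (projected-∪ (OrbFlag H F) (OrbFlag H F') i)
              (HasSize-⊎ ≈ₛ-isEquivalence
                (λ {W} {W'} → projected-OrbFlag-disjoint {F = F} {F'} i (Fᵢ≠F'ᵢ i) {W} {W'})
                (Fᵢ-size i) (F'ᵢ-size i))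

    IsDisjointFlagCode-OrbFlag-∪⇒SameSet : ∀ {r} {τ : FlagType r n} {F F' : Flag τ} i →
      SameSet (OrbSub H (sub F i)) (OrbSub H (sub F' i)) →
      IsDisjointFlagCode (OrbFlag H F) → IsDisjointFlagCode (OrbFlag H F ∪ OrbFlag H F') →
      SameSet (OrbFlag H F) (OrbFlag H F')
    IsDisjointFlagCode-OrbFlag-∪⇒SameSet {F = F} {F'} i Fᵢ≐F'ᵢ
      (_ , m , F-size , Fᵢ-size) (_ , k , ∪-size , ∪ᵢ-size) =
      let Y , F~Y , F'≈Y = HasSize-⊆-≤⇒⊇ ≈F-isEquivalence inj₁ F-size ∪-size k≤m {F'} (inj₂ F'~F')
      in same-orbit {F = F} {F'}
           (OrbFlag-respʳ {F = F} {Y} {F'} (IsEquivalence.sym ≈F-isEquivalence {F'} {Y} F'≈Y) F~Y)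
      where
      F'~F' : OrbFlag H F' F'
      F'~F' = IsEquivalence.refl OrbFlag-isEquivalence {F'}

      ∪ᵢ⊆Fᵢ : ∀ {W} → projected (OrbFlag H F ∪ OrbFlag H F') i W → projected (OrbFlag H F) i W
      ∪ᵢ⊆Fᵢ {W} W∈∪ᵢ with proj₂ (projected-∪ (OrbFlag H F) (OrbFlag H F') i W) W∈∪ᵢ
      ... | inj₁ W∈Fᵢ  = W∈Fᵢ
      ... | inj₂ W∈F'ᵢ =
        proj₂ (projected-OrbFlag F i W) (proj₂ (Fᵢ≐F'ᵢ W) (proj₁ (projected-OrbFlag F' i W) W∈F'ᵢ))

      k≤m : k ≤ m
      k≤m = HasSize-⊆⇒≤ ≈ₛ-isEquivalence (λ {W} → ∪ᵢ⊆Fᵢ {W}) (∪ᵢ-size i) (Fᵢ-size i)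

lemma4p12 : (q : ℕ) (K : FiniteField q) (n r : ℕ) →
    let open LinAlg K in
    (τ : FlagType r n) (F F' : Flag τ) (H : Matrix n n → Set) →
    IsSubgroupGL H →
    IsDisjointFlagCode (OrbFlag H F) →
    IsDisjointFlagCode (OrbFlag H F') →
    -- (a)
    ((∃ λ (i : Fin r) → ¬ SameSet (OrbSub H (sub F i)) (OrbSub H (sub F' i))) →
      ∀ m m' → HasSize _≈F_ (OrbFlag H F) m → HasSize _≈F_ (OrbFlag H F') m' →
      HasSize _≈F_ (OrbFlag H F ∪ OrbFlag H F') (m + m'))
    ×
    -- (b)
    (((i : Fin r) → ¬ SameSet (OrbSub H (sub F i)) (OrbSub H (sub F' i))) →
      IsDisjointFlagCode (OrbFlag H F ∪ OrbFlag H F'))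
    ×
    -- (c)
    ((∃ λ (i : Fin r) → SameSet (OrbSub H (sub F i)) (OrbSub H (sub F' i))) →
      (IsDisjointFlagCode (OrbFlag H F ∪ OrbFlag H F') →
         SameSet (OrbFlag H F) (OrbFlag H F'))
      ×
      (SameSet (OrbFlag H F) (OrbFlag H F') →
         IsDisjointFlagCode (OrbFlag H F ∪ OrbFlag H F')))
lemma4p12 q K n r τ F F' H H-subgroup F-code F'-code =
    (λ (i , Fᵢ≠F'ᵢ) m m' → HasSize-OrbFlag-∪ {F = F} {F'} i Fᵢ≠F'ᵢ)
  , IsDisjointFlagCode-OrbFlag-∪ {F = F} {F'} F-code F'-code
  , λ (i , Fᵢ≐F'ᵢ) →
        IsDisjointFlagCode-OrbFlag-∪⇒SameSet {F = F} {F'} i Fᵢ≐F'ᵢ F-code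
      , λ Orb[F]≐Orb[F'] → IsDisjointFlagCode-∪ Orb[F]≐Orb[F'] F-code
  where
  open FlagOrbits K
  open Orbits H-subgroup
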